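{- Let $k\geq 3$ be an odd integer and let $A=(a_0,\dots,a_{k-1})$ be the integer sequence with $a_0=a_{k-1}=1$, $a_i=-2$ for odd $i$ with $1\le i\le k-2$, and $a_i=2$ for even $i$ with $2\le i\le k-3$. For $i\in[0,k-1]$ let $A_i=(\alpha_{i,0},\dots,\alpha_{i,k-1})$ where $\alpha_{i,j}=j\cdot a_{i+j}$, with subscripts of $a$ taken modulo $k$ in $\{0,\dots,k-1\}$. Then, as integers: (a) $\sum_{j}a_j=\sum_j\alpha_{0,j}=0$; (b) $\sum_j\alpha_{i,j}=k$ for every odd $i\in[1,k-1]$; (c) $\sum_j\alpha_{i,j}=-k$ for every even $i\in[2,k-1]$.
   Context: $[a,b]$ denotes $\{a,a+1,\dots,b\}$. -}

module Defs where

open import Data.Nat using (ℕ; zero; suc; _+_; _∸_; _%_; _≟_)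
open import Data.Nat.Properties using ()
open import Data.Integer using (ℤ; +_; -_)
import Data.Integer as ℤ
open import Data.List using (List; []; _∷_; map; upTo)
open import Data.Bool using (Bool; true; false; if_then_else_)
open import Relation.Nullary.Decidable using (⌊_⌋)

isOdd : ℕ → Bool
isOdd zero = false
isOdd (suc n) with isOdd n
... | true = false
... | false = true

sumℤ : List ℤ → ℤ
sumℤ [] = + 0
sumℤ (x ∷ xs) = x ℤ.+ sumℤ xs

seqA : (k : ℕ) → ℕ → ℤ
seqA k i =
  if ⌊ i ≟ 0 ⌋ then + 1 else
  if ⌊ i ≟ k ∸ 1 ⌋ then + 1 else
  if isOdd i then - (+ 2) else + 2

alpha : (k : ℕ) → .{{_ : Data.Nat.NonZero k}} → ℕ → ℕ → ℤ
alpha k i j = (+ j) ℤ.* seqA k ((i + j) % k)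

sumRange : ℕ → (ℕ → ℤ) → ℤ
sumRange k f = sumℤ (map f (upTo k))

{-# OPTIONS --safe #-}
-- Write S i = Σ_j j · a((i + j) mod k).  Moving the window one step lowers every weight by one
-- and gives the freed weight k - 1 to a_i, so S (i+1) = S i - Σ_j a_j + k · a_i.  As Σ_j a_j = 0,
-- S i = S 0 + k · (a_0 + ⋯ + a_{i-1}), and the partial sums of A alternate 1, -1, 1, …, -1.
-- Finally S 0 = Σ_j j · a_j vanishes by summation by parts: it is k · Σ_j a_j minus the sum of
-- all k partial sums, and both are 0.
module Submission where

open import Defs
open import Data.Bool using (true; false; not; if_then_else_)
open import Data.Bool.Properties using (not-involutive)
open import Data.Integer using (ℤ; +_; -_; _+_; _*_)
import Data.Integer.Properties as ℤ
open import Data.Integer.Tactic.RingSolver using (solve-∀)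
open import Algebra.Properties.CommutativeSemigroup ℤ.+-commutativeSemigroup using (interchange)
open import Data.List.Properties using (map-applyUpTo)
open import Data.Nat using (ℕ; zero; suc; _≤_; _<_; _%_; _≟_; NonZero; s≤s; z<s; s<s)
import Data.Nat as ℕ
import Data.Nat.Properties as ℕ
open import Data.Nat.DivMod using ([m+n]%n≡m%n; m<n⇒m%n≡m)
open import Data.Product using (_×_; _,_)
open import Function using (id; _∘_)
open import Relation.Nullary using (yes; no; contradiction)
open import Relation.Binary.PropositionalEquality
  using (_≡_; refl; sym; trans; cong; cong₂; module ≡-Reasoning)
open ≡-Reasoning

sumRange-suc : ∀ n (f : ℕ → ℤ) → sumRange (suc n) f ≡ f 0 + sumRange n (f ∘ suc)
sumRange-suc n f = cong (λ xs → f 0 + sumℤ xs)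
  (trans (map-applyUpTo suc f n) (sym (map-applyUpTo id (f ∘ suc) n)))

sumRange-sucʳ : ∀ n (f : ℕ → ℤ) → sumRange (suc n) f ≡ sumRange n f + f n
sumRange-sucʳ zero    f = ℤ.+-comm (f 0) (+ 0)
sumRange-sucʳ (suc n) f = begin
  sumRange (suc (suc n)) f
    ≡⟨ sumRange-suc (suc n) f ⟩
  f 0 + sumRange (suc n) (f ∘ suc)
    ≡⟨ cong (_+_ (f 0)) (sumRange-sucʳ n (f ∘ suc)) ⟩
  f 0 + (sumRange n (f ∘ suc) + f (suc n))
    ≡⟨ ℤ.+-assoc (f 0) _ _ ⟨
  (f 0 + sumRange n (f ∘ suc)) + f (suc n)
    ≡⟨ cong (_+ f (suc n)) (sumRange-suc n f) ⟨
  sumRange (suc n) f + f (suc n) ∎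

sumRange-cong : ∀ n {f g : ℕ → ℤ} → (∀ {j} → j < n → f j ≡ g j) → sumRange n f ≡ sumRange n g
sumRange-cong zero    f≡g = refl
sumRange-cong (suc n) {f} {g} f≡g = begin
  sumRange (suc n) f
    ≡⟨ sumRange-suc n f ⟩
  f 0 + sumRange n (f ∘ suc)
    ≡⟨ cong₂ _+_ (f≡g z<s) (sumRange-cong n (f≡g ∘ s<s)) ⟩
  g 0 + sumRange n (g ∘ suc)
    ≡⟨ sumRange-suc n g ⟨
  sumRange (suc n) g ∎

sumRange-distrib-+ : ∀ n (f g : ℕ → ℤ) →
  sumRange n (λ j → f j + g j) ≡ sumRange n f + sumRange n g
sumRange-distrib-+ zero    f g = refl
sumRange-distrib-+ (suc n) f g = begin
  sumRange (suc n) (λ j → f j + g j)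
    ≡⟨ sumRange-sucʳ n _ ⟩
  sumRange n (λ j → f j + g j) + (f n + g n)
    ≡⟨ cong (_+ (f n + g n)) (sumRange-distrib-+ n f g) ⟩
  (sumRange n f + sumRange n g) + (f n + g n)
    ≡⟨ interchange (sumRange n f) (sumRange n g) (f n) (g n) ⟩
  (sumRange n f + f n) + (sumRange n g + g n)
    ≡⟨ cong₂ _+_ (sumRange-sucʳ n f) (sumRange-sucʳ n g) ⟨
  sumRange (suc n) f + sumRange (suc n) g ∎

sumRange-moment-suc : ∀ n (f : ℕ → ℤ) →
  sumRange (suc n) (λ j → + j * f j) ≡ sumRange n (f ∘ suc) + sumRange n (λ j → + j * f (suc j))
sumRange-moment-suc n f = begin
  sumRange (suc n) (λ j → + j * f j)
    ≡⟨ sumRange-suc n (λ j → + j * f j) ⟩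
  + 0 * f 0 + sumRange n (λ j → + suc j * f (suc j))
    ≡⟨ cong (_+_ (+ 0 * f 0)) (sumRange-cong n (λ {j} _ → ℤ.suc-* (+ j) (f (suc j)))) ⟩
  + 0 + sumRange n (λ j → f (suc j) + + j * f (suc j))
    ≡⟨ ℤ.+-identityˡ _ ⟩
  sumRange n (λ j → f (suc j) + + j * f (suc j))
    ≡⟨ sumRange-distrib-+ n (f ∘ suc) _ ⟩
  sumRange n (f ∘ suc) + sumRange n (λ j → + j * f (suc j)) ∎

sumRange-by-parts : ∀ n (a : ℕ → ℤ) →
  sumRange n (λ j → + j * a j) + sumRange n (λ i → sumRange (suc i) a) ≡ + n * sumRange n a
sumRange-by-parts zero    a = refl
sumRange-by-parts (suc n) a = begin
  sumRange (suc n) M + sumRange (suc n) P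
    ≡⟨ cong₂ _+_ (sumRange-sucʳ n M) (sumRange-sucʳ n P) ⟩
  (sumRange n M + + n * a n) + (sumRange n P + P n)
    ≡⟨ interchange (sumRange n M) _ (sumRange n P) _ ⟩
  (sumRange n M + sumRange n P) + (+ n * a n + P n)
    ≡⟨ cong (_+ (+ n * a n + P n)) (sumRange-by-parts n a) ⟩
  + n * sumRange n a + (+ n * a n + P n)
    ≡⟨ regroup (+ n) (sumRange n a) (a n) (P n) ⟩
  P n + + n * (sumRange n a + a n)
    ≡⟨ cong (λ s → P n + + n * s) (sumRange-sucʳ n a) ⟨
  P n + + n * P n
    ≡⟨ ℤ.suc-* (+ n) (P n) ⟨
  + suc n * P n ∎
  where
  M P : ℕ → ℤ
  M j = + j * a j
  P i = sumRange (suc i) a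
  regroup : ∀ m s x y → m * s + (m * x + y) ≡ y + m * (s + x)
  regroup = solve-∀

module Rotation (n : ℕ) (a : ℕ → ℤ) where

  rotate : ℕ → ℕ → ℤ
  rotate i j = a ((i ℕ.+ j) % suc n)

  moment : ℕ → ℤ
  moment i = sumRange (suc n) (λ j → + j * rotate i j)

  rotate-suc : ∀ i j → rotate (suc i) j ≡ rotate i (suc j)
  rotate-suc i j = cong (λ l → a (l % suc n)) (sym (ℕ.+-suc i j))

  rotate-zeroʳ : ∀ i → rotate i 0 ≡ a (i % suc n)
  rotate-zeroʳ i = cong (λ l → a (l % suc n)) (ℕ.+-identityʳ i)

  rotate-periodic : ∀ i → rotate i (suc n) ≡ rotate i 0
  rotate-periodic i = trans (cong a ([m+n]%n≡m%n i (suc n))) (sym (rotate-zeroʳ i))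

  rotate-zeroˡ : ∀ {j} → j < suc n → rotate 0 j ≡ a j
  rotate-zeroˡ j<k = cong a (m<n⇒m%n≡m j<k)

  sumRange-rotate : ∀ i → sumRange (suc n) (rotate i) ≡ sumRange (suc n) a
  sumRange-rotate zero    = sumRange-cong (suc n) rotate-zeroˡ
  sumRange-rotate (suc i) = begin
    sumRange (suc n) (rotate (suc i))
      ≡⟨ sumRange-cong (suc n) (λ {j} _ → rotate-suc i j) ⟩
    sumRange (suc n) (rotate i ∘ suc)
      ≡⟨ sumRange-sucʳ n (rotate i ∘ suc) ⟩
    sumRange n (rotate i ∘ suc) + rotate i (suc n)
      ≡⟨ cong (_+_ (sumRange n (rotate i ∘ suc))) (rotate-periodic i) ⟩
    sumRange n (rotate i ∘ suc) + rotate i 0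
      ≡⟨ ℤ.+-comm (sumRange n (rotate i ∘ suc)) (rotate i 0) ⟩
    rotate i 0 + sumRange n (rotate i ∘ suc)
      ≡⟨ sumRange-suc n (rotate i) ⟨
    sumRange (suc n) (rotate i)
      ≡⟨ sumRange-rotate i ⟩
    sumRange (suc n) a ∎

  moment-zero : moment 0 ≡ sumRange (suc n) (λ j → + j * a j)
  moment-zero = sumRange-cong (suc n) (λ {j} j<k → cong (+ j *_) (rotate-zeroˡ j<k))

  moment-suc : ∀ i → moment (suc i) + sumRange (suc n) a ≡ moment i + + suc n * rotate i 0
  moment-suc i = begin
    moment (suc i) + sumRange (suc n) a
      ≡⟨ cong₂ _+_ shifted-moment (sym (sumRange-rotate i)) ⟩
    (W + + n * f 0) + sumRange (suc n) f
      ≡⟨ cong (_+_ (W + + n * f 0)) (sumRange-suc n f) ⟩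
    (W + + n * f 0) + (f 0 + F)
      ≡⟨ regroup W F (f 0) (+ n) ⟩
    (F + W) + + suc n * f 0
      ≡⟨ cong (_+ + suc n * f 0) (sumRange-moment-suc n f) ⟨
    moment i + + suc n * f 0 ∎
    where
    f : ℕ → ℤ
    f = rotate i
    F W : ℤ
    F = sumRange n (f ∘ suc)
    W = sumRange n (λ j → + j * f (suc j))
    shifted-moment : moment (suc i) ≡ W + + n * f 0
    shifted-moment = begin
      moment (suc i)
        ≡⟨ sumRange-cong (suc n) (λ {j} _ → cong (+ j *_) (rotate-suc i j)) ⟩
      sumRange (suc n) (λ j → + j * f (suc j))
        ≡⟨ sumRange-sucʳ n _ ⟩
      W + + n * f (suc n)
        ≡⟨ cong (λ x → W + + n * x) (rotate-periodic i) ⟩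
      W + + n * f 0 ∎
    regroup : ∀ w s x m → (w + m * x) + (x + s) ≡ (s + w) + (+ 1 + m) * x
    regroup = solve-∀

  moment≡moment0+partialSum : sumRange (suc n) a ≡ + 0 →
    ∀ i → i ≤ suc n → moment i ≡ moment 0 + + suc n * sumRange i a
  moment≡moment0+partialSum Σa≡0 zero    _ =
    sym (trans (cong (_+_ (moment 0)) (ℤ.*-zeroʳ (+ suc n))) (ℤ.+-identityʳ (moment 0)))
  moment≡moment0+partialSum Σa≡0 (suc i) i<k = begin
    moment (suc i)
      ≡⟨ ℤ.+-identityʳ (moment (suc i)) ⟨
    moment (suc i) + + 0
      ≡⟨ cong (_+_ (moment (suc i))) Σa≡0 ⟨
    moment (suc i) + sumRange (suc n) a
      ≡⟨ moment-suc i ⟩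
    moment i + + suc n * rotate i 0
      ≡⟨ cong₂ (λ m x → m + + suc n * x)
               (moment≡moment0+partialSum Σa≡0 i (ℕ.<⇒≤ i<k))
               (trans (rotate-zeroʳ i) (cong a (m<n⇒m%n≡m i<k))) ⟩
    (moment 0 + + suc n * sumRange i a) + + suc n * a i
      ≡⟨ regroup (moment 0) (+ suc n) (sumRange i a) (a i) ⟩
    moment 0 + + suc n * (sumRange i a + a i)
      ≡⟨ cong (λ s → moment 0 + + suc n * s) (sumRange-sucʳ i a) ⟨
    moment 0 + + suc n * sumRange (suc i) a ∎
    where
    regroup : ∀ m k s x → (m + k * s) + k * x ≡ m + k * (s + x)
    regroup = solve-∀

±[_]_ : ℕ → ℤ → ℤ
±[ i ] x = if isOdd i then x else - x

isOdd-suc : ∀ n → isOdd (suc n) ≡ not (isOdd n)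
isOdd-suc n with isOdd n
... | true  = refl
... | false = refl

isOdd-suc-suc : ∀ n → isOdd (suc (suc n)) ≡ isOdd n
isOdd-suc-suc n = trans (isOdd-suc (suc n)) (trans (cong not (isOdd-suc n)) (not-involutive (isOdd n)))

odd-suc⇒even : ∀ n → isOdd (suc n) ≡ true → isOdd n ≡ false
odd-suc⇒even n odd = trans (sym (not-involutive (isOdd n))) (cong not (trans (sym (isOdd-suc n)) odd))

±-odd : ∀ i x → isOdd i ≡ true → ±[ i ] x ≡ x
±-odd i x odd rewrite odd = refl

±-even : ∀ i x → isOdd i ≡ false → ±[ i ] x ≡ - x
±-even i x even rewrite even = refl

±-suc : ∀ i x → ±[ suc i ] x ≡ ±[ i ] (- x)
±-suc i x rewrite isOdd-suc i with isOdd i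
... | true  = refl
... | false = sym (ℤ.neg-involutive x)

±-+ : ∀ i x y → ±[ i ] x + ±[ i ] y ≡ ±[ i ] (x + y)
±-+ i x y with isOdd i
... | true  = refl
... | false = sym (ℤ.neg-distrib-+ x y)

*-± : ∀ i x y → x * ±[ i ] y ≡ ±[ i ] (x * y)
*-± i x y with isOdd i
... | true  = refl
... | false = sym (ℤ.neg-distribʳ-* x y)

±-cancel-suc : ∀ i x → ±[ i ] x + ±[ suc i ] x ≡ + 0
±-cancel-suc i x rewrite isOdd-suc i with isOdd i
... | true  = ℤ.+-inverseʳ x
... | false = ℤ.+-inverseˡ x

sumRange-± : ∀ n x → isOdd n ≡ false → sumRange n (λ i → ±[ i ] x) ≡ + 0
sumRange-± zero          x _    = refl
sumRange-± (suc zero)    x ()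
sumRange-± (suc (suc n)) x even = begin
  sumRange (suc (suc n)) g
    ≡⟨ sumRange-sucʳ (suc n) g ⟩
  sumRange (suc n) g + g (suc n)
    ≡⟨ cong (_+ g (suc n)) (sumRange-sucʳ n g) ⟩
  (sumRange n g + g n) + g (suc n)
    ≡⟨ ℤ.+-assoc (sumRange n g) (g n) (g (suc n)) ⟩
  sumRange n g + (g n + g (suc n))
    ≡⟨ cong₂ _+_ (sumRange-± n x n-even) (±-cancel-suc n x) ⟩
  + 0 ∎
  where
  g : ℕ → ℤ
  g i = ±[ i ] x
  n-even : isOdd n ≡ false
  n-even = trans (sym (isOdd-suc-suc n)) even

seqA-middle : ∀ n l → 0 < l → l < n → seqA (suc n) l ≡ ±[ l ] (- + 2)
seqA-middle n (suc l) _ l<n with suc l ≟ n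
... | yes l≡n = contradiction l≡n (ℕ.<⇒≢ l<n)
... | no  _   = refl

seqA-last : ∀ n → seqA (suc n) n ≡ + 1
seqA-last zero    = refl
seqA-last (suc n) with suc n ≟ suc n
... | yes _   = refl
... | no  n≢n = contradiction refl n≢n

seqA-partialSum : ∀ n i → 0 < i → i ≤ n → sumRange i (seqA (suc n)) ≡ ±[ i ] (+ 1)
seqA-partialSum n (suc zero)    _ _      = refl
seqA-partialSum n (suc (suc i)) _ 2+i≤n = begin
  sumRange (suc (suc i)) a
    ≡⟨ sumRange-sucʳ (suc i) a ⟩
  sumRange (suc i) a + a (suc i)
    ≡⟨ cong₂ _+_ (seqA-partialSum n (suc i) z<s (ℕ.<⇒≤ 2+i≤n))
                 (seqA-middle n (suc i) z<s 2+i≤n) ⟩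
  ±[ suc i ] (+ 1) + ±[ suc i ] (- + 2)
    ≡⟨ ±-+ (suc i) (+ 1) (- + 2) ⟩
  ±[ suc i ] (- + 1)
    ≡⟨ ±-suc (suc i) (+ 1) ⟨
  ±[ suc (suc i) ] (+ 1) ∎
  where
  a : ℕ → ℤ
  a = seqA (suc n)

module _ {n : ℕ} (0<n : 0 < n) (n-even : isOdd n ≡ false) where

  seqA-sum : sumRange (suc n) (seqA (suc n)) ≡ + 0
  seqA-sum = trans (sumRange-sucʳ n (seqA (suc n)))
    (cong₂ _+_ (trans (seqA-partialSum n n 0<n ℕ.≤-refl) (±-even n (+ 1) n-even)) (seqA-last n))

  seqA-moment : sumRange (suc n) (λ j → + j * seqA (suc n) j) ≡ + 0
  seqA-moment = begin
    M
      ≡⟨ ℤ.+-identityʳ M ⟨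
    M + + 0
      ≡⟨ cong (_+_ M) partialSums ⟨
    M + sumRange (suc n) (λ i → sumRange (suc i) a)
      ≡⟨ sumRange-by-parts (suc n) a ⟩
    + suc n * sumRange (suc n) a
      ≡⟨ cong (_*_ (+ suc n)) seqA-sum ⟩
    + suc n * + 0
      ≡⟨ ℤ.*-zeroʳ (+ suc n) ⟩
    + 0 ∎
    where
    a : ℕ → ℤ
    a = seqA (suc n)
    M : ℤ
    M = sumRange (suc n) (λ j → + j * a j)
    partialSums : sumRange (suc n) (λ i → sumRange (suc i) a) ≡ + 0
    partialSums = begin
      sumRange (suc n) (λ i → sumRange (suc i) a)
        ≡⟨ sumRange-sucʳ n _ ⟩
      sumRange n (λ i → sumRange (suc i) a) + sumRange (suc n) a
        ≡⟨ cong₂ _+_ (sumRange-cong n alternating) seqA-sum ⟩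
      sumRange n (λ i → ±[ i ] (- + 1)) + + 0
        ≡⟨ cong (_+ + 0) (sumRange-± n (- + 1) n-even) ⟩
      + 0 ∎
      where
      alternating : ∀ {i} → i < n → sumRange (suc i) a ≡ ±[ i ] (- + 1)
      alternating {i} i<n = trans (seqA-partialSum n (suc i) z<s i<n) (±-suc i (+ 1))

  open Rotation n (seqA (suc n)) using (moment; moment-zero; moment≡moment0+partialSum)

  seqA-rotated-moment : ∀ i → 0 < i → i ≤ n → moment i ≡ ±[ i ] (+ suc n)
  seqA-rotated-moment i 0<i i≤n = begin
    moment i
      ≡⟨ moment≡moment0+partialSum seqA-sum i (ℕ.m≤n⇒m≤1+n i≤n) ⟩
    moment 0 + + suc n * sumRange i (seqA (suc n))
      ≡⟨ cong₂ (λ m s → m + + suc n * s) moment0≡0 (seqA-partialSum n i 0<i i≤n) ⟩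
    + 0 + + suc n * ±[ i ] (+ 1)
      ≡⟨ ℤ.+-identityˡ _ ⟩
    + suc n * ±[ i ] (+ 1)
      ≡⟨ *-± i (+ suc n) (+ 1) ⟩
    ±[ i ] (+ suc n * + 1)
      ≡⟨ cong ±[ i ]_ (ℤ.*-identityʳ (+ suc n)) ⟩
    ±[ i ] (+ suc n) ∎
    where
    moment0≡0 : moment 0 ≡ + 0
    moment0≡0 = trans moment-zero seqA-moment

lemma2p3 : (k : ℕ) → .{{_ : NonZero k}} → 3 ≤ k → isOdd k ≡ true →
    (sumRange k (seqA k) ≡ + 0 × sumRange k (alpha k 0) ≡ + 0)
    × (∀ i → 1 ≤ i → i < k → isOdd i ≡ true → sumRange k (alpha k i) ≡ + k)
    × (∀ i → 2 ≤ i → i < k → isOdd i ≡ false → sumRange k (alpha k i) ≡ - (+ k))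
lemma2p3 (suc n) (s≤s 2≤n) k-odd =
    (seqA-sum 0<n n-even , trans moment-zero (seqA-moment 0<n n-even))
  , (λ i 1≤i i<k i-odd →
       trans (seqA-rotated-moment 0<n n-even i 1≤i (ℕ.≤-pred i<k))
             (±-odd i (+ suc n) i-odd))
  , (λ i 2≤i i<k i-even →
       trans (seqA-rotated-moment 0<n n-even i (ℕ.<-≤-trans z<s 2≤i) (ℕ.≤-pred i<k))
             (±-even i (+ suc n) i-even))
  where
  open Rotation n (seqA (suc n)) using (moment-zero)
  0<n : 0 < n
  0<n = ℕ.<-≤-trans z<s 2≤n
  n-even : isOdd n ≡ false
  n-even = odd-suc⇒even n k-odd
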